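{- For every complex $\alpha$ and every positive integer $n$, $$\sum_{k=0}^n\binom{\alpha+1}{n-k}\binom{\alpha+k}{k}(-1)^{n-k}H_k=\frac1n+\binom{\alpha}{n}\frac{(-1)^{n-1}}{n},$$ $$\sum_{k=0}^n\binom{\alpha}{n-k}\binom{\alpha+k}{k}(-1)^{n-k}H_k=H_n+\sum_{k=1}^n\binom{\alpha}{k}\frac{(-1)^{k-1}}{k}.$$ In particular, taking $\alpha=n$, $$\sum_{k=0}^n\binom{n+1}{n-k}\binom{n+k}{k}(-1)^{n-k}H_k=\frac{1+(-1)^{n-1}}{n},\qquad \sum_{k=0}^n\binom{n}{n-k}\binom{n+k}{k}(-1)^{n-k}H_k=2H_n.$$
   Context: $H_k=1+\frac12+\dots+\frac1k$, $H_0=0$, are the harmonic numbers; $\binom{\beta}{j}=\beta(\beta-1)\cdots(\beta-j+1)/j!$ is the generalized binomial coefficient. -}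

module Defs where

open import Level using (Level)
open import Data.Nat using (ℕ; zero; suc; _∸_)
open import Data.Integer using (+_)
open import Data.Rational as ℚ using (ℚ; _/_; 0ℚ; 1ℚ)
open import Data.Rational.Properties using (+-*-commutativeRing)
open import Algebra.Bundles using (CommutativeRing)
open import Algebra.Morphism.Structures using (module RingMorphisms)

recipSuc : ℕ → ℚ
recipSuc k = + 1 / suc k

harmonic : ℕ → ℚ
harmonic zero    = 0ℚ
harmonic (suc k) = harmonic k ℚ.+ recipSuc k

invFact : ℕ → ℚ
invFact zero    = 1ℚ
invFact (suc j) = invFact j ℚ.* recipSuc j

natℚ : ℕ → ℚ
natℚ n = + n / 1

-- A ℚ-algebra: a commutative ring R together with a ring homomorphism ι : ℚ → R.
-- (ℂ is such an algebra, with ι the inclusion.)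
IsℚAlgebraMap : ∀ {c ℓ} (R : CommutativeRing c ℓ) → (ℚ → CommutativeRing.Carrier R) → Set _
IsℚAlgebraMap R ι =
  RingMorphisms.IsRingHomomorphism
    (CommutativeRing.rawRing +-*-commutativeRing) (CommutativeRing.rawRing R) ι

module QAlg {c ℓ : Level} (R : CommutativeRing c ℓ) (ι : ℚ → CommutativeRing.Carrier R) where
  open CommutativeRing R hiding (zero)

  falling : Carrier → ℕ → Carrier
  falling a zero    = 1#
  falling a (suc j) = falling a j * (a - ι (natℚ j))

  binom : Carrier → ℕ → Carrier
  binom a j = ι (invFact j) * falling a j

  sign : ℕ → Carrier
  sign zero    = 1#
  sign (suc m) = - sign m

  H : ℕ → Carrier
  H k = ι (harmonic k)

  nat : ℕ → Carrier
  nat n = ι (natℚ n)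

  sum0 : ℕ → (ℕ → Carrier) → Carrier
  sum0 zero    f = f zero
  sum0 (suc n) f = sum0 n f + f (suc n)

  sum1 : ℕ → (ℕ → Carrier) → Carrier
  sum1 zero    f = 0#
  sum1 (suc n) f = sum1 n f + f (suc n)

  -- 1/k in R for k ≥ 1, written for k = suc m
  invSuc : ℕ → Carrier
  invSuc m = ι (recipSuc m)

-- Write c(β,α,j,k) = C(β,j) C(α+k,k) (-1)^j and S(β,α,h,n) = Σ_{k=0}^{n} c(β,α,n-k,k) h_k.
-- The four sums of the corollary are S(α+1,α,H,n), S(α,α,H,n), S(n+1,n,H,n), S(n,n,H,n).
-- Two consequences of Pascal's rule drive the proof:
--   (1) S(α,α,h,n) = S(α+1,α,h,n) + S(α,α,h,n-1)                         (termwise Pascal);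
--   (2) n·c(α+1,α,n-k,k) = w_k - w_{k+1} for w_k = k·c(α,α,n-k,k), so summation by parts
--       gives  n·S(α+1,α,h,n) = Σ_{k=1}^{n} w_k (h_k - h_{k-1}).
-- For h ≡ 1, (2) gives S(α+1,α,1,n) = 0, hence S(α,α,1,n) = 1 by (1) (Chu–Vandermonde).
-- For h = H the summand of (2) is w_k/k = c(α,α,n-k,k), so n·S(α+1,α,H,n) is S(α,α,1,n)
-- minus its k = 0 term: this is the first identity, and telescoping it with (1) gives
-- the second.  At α = n the third follows from C(n,n) = 1, the fourth from
-- G(n,n) = H_n where G(a,N) = Σ_{k=1}^{N} C(a,k)(-1)^{k-1}/k; that last fact compares
-- G at consecutive upper arguments through Σ_{k=1}^{N} (-1)^{k-1} C(a+1,k) = 1 - (-1)^N C(a,N).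
module Submission where

open import Defs
open import Level using (Level)
open import Data.Nat as ℕ using (ℕ; zero; suc; _∸_; _≤_)
import Data.Nat.Properties as ℕP
open import Data.Nat.Coprimality as Coprime using (1-coprimeTo)
open import Data.Integer as ℤ using (+_)
import Data.Integer.Properties as ℤP
open import Data.Rational as ℚ using (ℚ; mkℚ; _/_; 1ℚ)
open import Data.Rational.Properties using (↥p/↧p≡p; *-inverseʳ; +-*-commutativeRing)
open import Data.Product using (_×_; _,_; proj₁; proj₂)
open import Data.Maybe using (Maybe; just; nothing)
open import Relation.Nullary using (yes; no)
open import Relation.Binary.PropositionalEquality as ≡ using (_≡_; cong; cong₂)
open import Algebra.Bundles using (CommutativeRing)
open import Algebra.Morphism.Structures using (module RingMorphisms)
import Algebra.Solver.Ring.AlmostCommutativeRing as ACR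

natℚ-normal : ∀ k → natℚ k ≡ mkℚ (+ k) 0 (Coprime.sym (1-coprimeTo k))
natℚ-normal k = ↥p/↧p≡p (mkℚ (+ k) 0 (Coprime.sym (1-coprimeTo k)))

recipSuc-normal : ∀ k → recipSuc k ≡ mkℚ (+ 1) k (1-coprimeTo (suc k))
recipSuc-normal k = ↥p/↧p≡p (mkℚ (+ 1) k (1-coprimeTo (suc k)))

natℚ-suc : ∀ k → natℚ (suc k) ≡ natℚ k ℚ.+ 1ℚ
natℚ-suc k = ≡.sym (≡.trans (cong (ℚ._+ 1ℚ) (natℚ-normal k)) (cong (_/ 1) numerator))
  where
  numerator : + k ℤ.* + 1 ℤ.+ + 1 ℤ.* + 1 ≡ + suc k
  numerator = ≡.trans (cong (ℤ._+ + 1) (ℤP.*-identityʳ (+ k))) (ℤP.+-comm (+ k) (+ 1))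

natℚ-*-recipSuc : ∀ k → natℚ (suc k) ℚ.* recipSuc k ≡ 1ℚ
natℚ-*-recipSuc k =
  ≡.trans (cong₂ ℚ._*_ (natℚ-normal (suc k)) (recipSuc-normal k))
          (*-inverseʳ (mkℚ (+ suc k) 0 (Coprime.sym (1-coprimeTo (suc k)))))

index-split : ∀ {k m} → k ≤ m → suc m ∸ k ≡ suc (m ∸ k) × k ℕ.+ suc (m ∸ k) ≡ suc m
index-split {k} {m} k≤m =
  ℕP.+-∸-assoc 1 k≤m , ≡.trans (ℕP.+-suc k (m ∸ k)) (cong suc (ℕP.m+[n∸m]≡n k≤m))

module InℚAlgebra {r ℓ : Level} (R : CommutativeRing r ℓ) (ι : ℚ → CommutativeRing.Carrier R)
                  (ι-hom : IsℚAlgebraMap R ι) where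
  open CommutativeRing R hiding (zero)
  open QAlg R ι
  private module ι = RingMorphisms.IsRingHomomorphism ι-hom
  open import Relation.Binary.Reasoning.Setoid setoid
  open import Algebra.Properties.Ring ring using ([y-z]x≈yx-zx; -0#≈0#)

  private
    ACR-R : ACR.AlmostCommutativeRing r ℓ
    ACR-R = ACR.fromCommutativeRing R
    ι-morphism : CommutativeRing.rawRing +-*-commutativeRing ACR.-Raw-AlmostCommutative⟶ ACR-R
    ι-morphism = record { ⟦_⟧ = ι ; +-homo = ι.+-homo ; *-homo = ι.*-homo ; -‿homo = ι.-‿homo
                        ; 0-homo = ι.0#-homo ; 1-homo = ι.1#-homo }
    ι-equal? : ∀ p q → Maybe (ι p ≈ ι q)
    ι-equal? p q with p ℚ.≟ q
    ... | yes ≡.refl = just refl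
    ... | no _       = nothing
  open import Algebra.Solver.Ring (CommutativeRing.rawRing +-*-commutativeRing) ACR-R ι-morphism ι-equal?

  nat-zero : nat 0 ≈ 0#
  nat-zero = ι.0#-homo

  nat-suc : ∀ k → nat (suc k) ≈ nat k + 1#
  nat-suc k = trans (reflexive (cong ι (natℚ-suc k)))
                    (trans (ι.+-homo (natℚ k) 1ℚ) (+-cong refl ι.1#-homo))

  nat-+ : ∀ a b → nat (a ℕ.+ b) ≈ nat a + nat b
  nat-+ zero    b = sym (trans (+-cong nat-zero refl) (+-identityˡ (nat b)))
  nat-+ (suc a) b = begin
    nat (suc (a ℕ.+ b))   ≈⟨ trans (nat-suc (a ℕ.+ b)) (+-cong (nat-+ a b) refl) ⟩
    nat a + nat b + 1#    ≈⟨ solve 3 (λ x y u → x :+ y :+ u := x :+ u :+ y) refl (nat a) (nat b) 1# ⟩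
    nat a + 1# + nat b    ≈⟨ +-cong (sym (nat-suc a)) refl ⟩
    nat (suc a) + nat b   ∎

  nat-*-invSuc : ∀ k → nat (suc k) * invSuc k ≈ 1#
  nat-*-invSuc k = trans (sym (ι.*-homo (natℚ (suc k)) (recipSuc k)))
                         (trans (reflexive (cong ι (natℚ-*-recipSuc k))) ι.1#-homo)

  nat-divide : ∀ k {x y} → nat (suc k) * x ≈ y → x ≈ invSuc k * y
  nat-divide k {x} {y} eq = begin
    x                              ≈⟨ sym (trans (*-cong (nat-*-invSuc k) refl) (*-identityˡ x)) ⟩
    nat (suc k) * invSuc k * x     ≈⟨ solve 3 (λ N I x → N :* I :* x := I :* (N :* x)) refl (nat (suc k)) (invSuc k) x ⟩
    invSuc k * (nat (suc k) * x)   ≈⟨ *-cong refl eq ⟩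
    invSuc k * y                   ∎

  nat-cancel : ∀ k {x y} → nat (suc k) * x ≈ nat (suc k) * y → x ≈ y
  nat-cancel k {x} {y} eq = begin
    x                              ≈⟨ nat-divide k eq ⟩
    invSuc k * (nat (suc k) * y)   ≈⟨ solve 3 (λ N I y → I :* (N :* y) := N :* I :* y) refl (nat (suc k)) (invSuc k) y ⟩
    nat (suc k) * invSuc k * y     ≈⟨ trans (*-cong (nat-*-invSuc k) refl) (*-identityˡ y) ⟩
    y                              ∎

  falling-cong : ∀ {a b} j → a ≈ b → falling a j ≈ falling b j
  falling-cong zero    a≈b = refl
  falling-cong (suc j) a≈b = *-cong (falling-cong j a≈b) (+-cong a≈b refl)

  binom-cong : ∀ {a b} j → a ≈ b → binom a j ≈ binom b j
  binom-cong j a≈b = *-cong refl (falling-cong j a≈b)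

  binom-zero : ∀ a → binom a 0 ≈ 1#
  binom-zero a = trans (*-identityʳ (ι 1ℚ)) ι.1#-homo

  nat-*-binom-suc : ∀ a i → nat (suc i) * binom a (suc i) ≈ ι (invFact i) * falling a (suc i)
  nat-*-binom-suc a i = begin
    nat (suc i) * (ι (invFact i ℚ.* recipSuc i) * falling a (suc i))
      ≈⟨ *-cong refl (*-cong (ι.*-homo (invFact i) (recipSuc i)) refl) ⟩
    nat (suc i) * (ι (invFact i) * invSuc i * falling a (suc i))
      ≈⟨ solve 4 (λ N F I X → N :* (F :* I :* X) := N :* I :* (F :* X)) refl
           (nat (suc i)) (ι (invFact i)) (invSuc i) (falling a (suc i)) ⟩
    nat (suc i) * invSuc i * (ι (invFact i) * falling a (suc i))
      ≈⟨ trans (*-cong (nat-*-invSuc i) refl) (*-identityˡ _) ⟩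
    ι (invFact i) * falling a (suc i) ∎

  binom-suc : ∀ a i → nat (suc i) * binom a (suc i) ≈ (a - nat i) * binom a i
  binom-suc a i = trans (nat-*-binom-suc a i)
    (solve 3 (λ F X Y → F :* (X :* Y) := Y :* (F :* X)) refl (ι (invFact i)) (falling a i) (a - nat i))

  falling-shift : ∀ a j → falling (a + 1#) (suc j) ≈ (a + 1#) * falling a j
  falling-shift a zero = begin
    1# * (a + 1# - nat 0)    ≈⟨ *-identityˡ _ ⟩
    a + 1# - nat 0           ≈⟨ solve 2 (λ a u → a :+ u :- con (natℚ 0) := (a :+ u) :* con 1ℚ) refl a 1# ⟩
    (a + 1#) * ι 1ℚ          ≈⟨ *-cong refl ι.1#-homo ⟩
    (a + 1#) * 1#            ∎
  falling-shift a (suc j) = begin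
    falling (a + 1#) (suc j) * (a + 1# - nat (suc j))
      ≈⟨ *-cong (falling-shift a j) (+-cong refl (-‿cong (nat-suc j))) ⟩
    (a + 1#) * falling a j * (a + 1# - (nat j + 1#))
      ≈⟨ solve 4 (λ a u F N → (a :+ u) :* F :* (a :+ u :- (N :+ u)) := (a :+ u) :* (F :* (a :- N))) refl
           a 1# (falling a j) (nat j) ⟩
    (a + 1#) * (falling a j * (a - nat j)) ∎

  absorption : ∀ a i → nat (suc i) * binom (a + 1#) (suc i) ≈ (a + 1#) * binom a i
  absorption a i = trans (nat-*-binom-suc (a + 1#) i) (trans (*-cong refl (falling-shift a i))
    (solve 3 (λ F A X → F :* (A :* X) := A :* (F :* X)) refl (ι (invFact i)) (a + 1#) (falling a i)))

  pascal : ∀ a i → binom (a + 1#) (suc i) ≈ binom a (suc i) + binom a i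
  pascal a i = nat-cancel i (begin
    nat (suc i) * binom (a + 1#) (suc i)                  ≈⟨ absorption a i ⟩
    (a + 1#) * binom a i
      ≈⟨ solve 4 (λ a u N B → (a :+ u) :* B := (a :- N) :* B :+ (N :+ u) :* B) refl a 1# (nat i) (binom a i) ⟩
    (a - nat i) * binom a i + (nat i + 1#) * binom a i    ≈⟨ +-cong (sym (binom-suc a i)) (*-cong (sym (nat-suc i)) refl) ⟩
    nat (suc i) * binom a (suc i) + nat (suc i) * binom a i ≈⟨ sym (distribˡ _ _ _) ⟩
    nat (suc i) * (binom a (suc i) + binom a i)           ∎)

  binom-diagonal : ∀ N → binom (nat N) N ≈ 1#
  binom-diagonal zero    = binom-zero (nat 0)
  binom-diagonal (suc N) = nat-cancel N (begin
    nat (suc N) * binom (nat (suc N)) (suc N)   ≈⟨ *-cong refl (binom-cong (suc N) (nat-suc N)) ⟩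
    nat (suc N) * binom (nat N + 1#) (suc N)    ≈⟨ absorption (nat N) N ⟩
    (nat N + 1#) * binom (nat N) N              ≈⟨ *-cong (sym (nat-suc N)) (binom-diagonal N) ⟩
    nat (suc N) * 1#                            ∎)

  -- C(N, N+1) = 0, since the falling factorial contains the factor N - N.
  binom-above-diagonal : ∀ N → binom (nat N) (suc N) ≈ 0#
  binom-above-diagonal N =
    trans (*-cong refl (trans (*-cong refl (-‿inverseʳ (nat N))) (zeroʳ _))) (zeroʳ _)

  sum0-cong : ∀ n {f g : ℕ → Carrier} → (∀ k → k ≤ n → f k ≈ g k) → sum0 n f ≈ sum0 n g
  sum0-cong zero    f≈g = f≈g 0 ℕ.z≤n
  sum0-cong (suc n) f≈g =
    +-cong (sum0-cong n (λ k k≤n → f≈g k (ℕP.m≤n⇒m≤1+n k≤n))) (f≈g (suc n) ℕP.≤-refl)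

  sum1-cong : ∀ n {f g : ℕ → Carrier} → (∀ j → f (suc j) ≈ g (suc j)) → sum1 n f ≈ sum1 n g
  sum1-cong zero    f≈g = refl
  sum1-cong (suc n) f≈g = +-cong (sum1-cong n f≈g) (f≈g n)

  sum1-zero : ∀ n (f : ℕ → Carrier) → (∀ j → f (suc j) ≈ 0#) → sum1 n f ≈ 0#
  sum1-zero zero    f f≈0 = refl
  sum1-zero (suc n) f f≈0 = trans (+-cong (sum1-zero n f f≈0) (f≈0 n)) (+-identityʳ 0#)

  sum0-split : ∀ n (f : ℕ → Carrier) → sum0 n f ≈ f 0 + sum1 n f
  sum0-split zero    f = sym (+-identityʳ (f 0))
  sum0-split (suc n) f = trans (+-cong (sum0-split n f) refl) (+-assoc _ _ _)

  sum0-scale : ∀ n x (f : ℕ → Carrier) → x * sum0 n f ≈ sum0 n (λ k → x * f k)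
  sum0-scale zero    x f = refl
  sum0-scale (suc n) x f = trans (distribˡ x _ _) (+-cong (sum0-scale n x f) refl)

  sum0-+ : ∀ n (f g : ℕ → Carrier) → sum0 n (λ k → f k + g k) ≈ sum0 n f + sum0 n g
  sum0-+ zero    f g = refl
  sum0-+ (suc n) f g = trans (+-cong (sum0-+ n f g) refl)
    (solve 4 (λ a b c d → a :+ b :+ (c :+ d) := a :+ c :+ (b :+ d)) refl (sum0 n f) (sum0 n g) (f (suc n)) (g (suc n)))

  sum1-scale-sub : ∀ n x (f g : ℕ → Carrier) → x * (sum1 n f - sum1 n g) ≈ sum1 n (λ k → x * (f k - g k))
  sum1-scale-sub zero    x f g = trans (*-cong refl (-‿inverseʳ 0#)) (zeroʳ x)
  sum1-scale-sub (suc n) x f g = trans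
    (solve 5 (λ x a b c d → x :* (a :+ c :- (b :+ d)) := x :* (a :- b) :+ x :* (c :- d)) refl
      x (sum1 n f) (sum1 n g) (f (suc n)) (g (suc n)))
    (+-cong (sum1-scale-sub n x f g) refl)

  summation-by-parts : ∀ N (u h : ℕ → Carrier) →
    sum0 N (λ k → (u k - u (suc k)) * h k) + u (suc N) * h (suc N)
      ≈ u 0 * h 0 + sum1 (suc N) (λ k → u k * (h k - h (k ∸ 1)))
  summation-by-parts zero u h = trans
    (solve 4 (λ u₀ u₁ h₀ h₁ → (u₀ :- u₁) :* h₀ :+ u₁ :* h₁ := u₀ :* h₀ :+ u₁ :* (h₁ :- h₀)) refl (u 0) (u 1) (h 0) (h 1))
    (+-cong refl (sym (+-identityˡ _)))
  summation-by-parts (suc N) u h = begin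
    sum0 N F + (u (suc N) - u (suc (suc N))) * h (suc N) + u (suc (suc N)) * h (suc (suc N))
      ≈⟨ solve 5 (λ S u₁ u₂ h₁ h₂ → S :+ (u₁ :- u₂) :* h₁ :+ u₂ :* h₂ := S :+ u₁ :* h₁ :+ u₂ :* (h₂ :- h₁)) refl
           (sum0 N F) (u (suc N)) (u (suc (suc N))) (h (suc N)) (h (suc (suc N))) ⟩
    sum0 N F + u (suc N) * h (suc N) + D (suc (suc N))  ≈⟨ +-cong (summation-by-parts N u h) refl ⟩
    u 0 * h 0 + sum1 (suc N) D + D (suc (suc N))        ≈⟨ +-assoc _ _ _ ⟩
    u 0 * h 0 + sum1 (suc (suc N)) D                    ∎
    where
    F D : ℕ → Carrier
    F k = (u k - u (suc k)) * h k
    D k = u k * (h k - h (k ∸ 1))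

  coeff : Carrier → Carrier → ℕ → ℕ → Carrier
  coeff β α j k = binom β j * binom (α + nat k) k * sign j

  S : Carrier → Carrier → (ℕ → Carrier) → ℕ → Carrier
  S β α h n = sum0 n (λ k → coeff β α (n ∸ k) k * h k)

  coeff-last : ∀ β γ α n → coeff β α (n ∸ n) n ≡ coeff γ α (n ∸ n) n
  coeff-last β γ α n rewrite ℕP.n∸n≡0 n = ≡.refl

  coeff-pascal : ∀ α j k → coeff α α (suc j) k ≈ coeff (α + 1#) α (suc j) k + coeff α α j k
  coeff-pascal α j k = begin
    binom α (suc j) * B * - sign j
      ≈⟨ solve 4 (λ C₁ C₀ B s → C₁ :* B :* (:- s) := (C₁ :+ C₀) :* B :* (:- s) :+ C₀ :* B :* s) refl
           (binom α (suc j)) (binom α j) B (sign j) ⟩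
    (binom α (suc j) + binom α j) * B * - sign j + binom α j * B * sign j
      ≈⟨ +-cong (*-cong (*-cong (sym (pascal α j)) refl) refl) refl ⟩
    binom (α + 1#) (suc j) * B * - sign j + binom α j * B * sign j ∎
    where B = binom (α + nat k) k

  S-recurrence : ∀ α h m → S α α h (suc m) ≈ S (α + 1#) α h (suc m) + S α α h m
  S-recurrence α h m = begin
    sum0 m (λ k → coeff α α (n ∸ k) k * h k) + coeff α α (n ∸ n) n * h n
      ≈⟨ +-cong (sum0-cong m split) (*-cong (reflexive (coeff-last α (α + 1#) α n)) refl) ⟩
    sum0 m (λ k → T k + P k) + T n      ≈⟨ +-cong (sum0-+ m T P) refl ⟩
    sum0 m T + sum0 m P + T n           ≈⟨ solve 3 (λ A B c → A :+ B :+ c := A :+ c :+ B) refl (sum0 m T) (sum0 m P) (T n) ⟩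
    sum0 m T + T n + sum0 m P           ∎
    where
    n = suc m
    T P : ℕ → Carrier
    T k = coeff (α + 1#) α (n ∸ k) k * h k
    P k = coeff α α (m ∸ k) k * h k
    split : ∀ k → k ≤ m → coeff α α (n ∸ k) k * h k ≈ T k + P k
    split k k≤m = begin
      coeff α α (n ∸ k) k * h k                                   ≡⟨ cong (λ j → coeff α α j k * h k) n∸k≡ ⟩
      coeff α α (suc (m ∸ k)) k * h k                             ≈⟨ *-cong (coeff-pascal α (m ∸ k) k) refl ⟩
      (coeff (α + 1#) α (suc (m ∸ k)) k + coeff α α (m ∸ k) k) * h k ≈⟨ distribʳ (h k) _ _ ⟩
      coeff (α + 1#) α (suc (m ∸ k)) k * h k + P k                ≡⟨ cong (λ j → coeff (α + 1#) α j k * h k + P k) (≡.sym n∸k≡) ⟩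
      T k + P k                                                   ∎
      where
      n∸k≡ : n ∸ k ≡ suc (m ∸ k)
      n∸k≡ = proj₁ (index-split k≤m)

  weight : Carrier → ℕ → ℕ → Carrier
  weight α n k = nat k * coeff α α (n ∸ k) k

  pascal-weighted : ∀ α x j →
    (x + nat (suc j)) * binom (α + 1#) (suc j) ≈ x * binom α (suc j) + (α + x + 1#) * binom α j
  pascal-weighted α x j = begin
    (x + nat (suc j)) * binom (α + 1#) (suc j)
      ≈⟨ *-cong refl (pascal α j) ⟩
    (x + nat (suc j)) * (C₁ + C₀)
      ≈⟨ solve 4 (λ x N C₁ C₀ → (x :+ N) :* (C₁ :+ C₀) := x :* C₁ :+ N :* C₁ :+ (x :+ N) :* C₀) refl x (nat (suc j)) C₁ C₀ ⟩
    x * C₁ + nat (suc j) * C₁ + (x + nat (suc j)) * C₀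
      ≈⟨ +-cong (+-cong refl (binom-suc α j)) (*-cong (+-cong refl (nat-suc j)) refl) ⟩
    x * C₁ + (α - nat j) * C₀ + (x + (nat j + 1#)) * C₀
      ≈⟨ solve 6 (λ α x u N C₁ C₀ → x :* C₁ :+ (α :- N) :* C₀ :+ (x :+ (N :+ u)) :* C₀ := x :* C₁ :+ (α :+ x :+ u) :* C₀) refl
           α x 1# (nat j) C₁ C₀ ⟩
    x * C₁ + (α + x + 1#) * C₀ ∎
    where
    C₁ = binom α (suc j)
    C₀ = binom α j

  absorption-shifted : ∀ α k → nat (suc k) * binom (α + nat (suc k)) (suc k) ≈ (α + nat k + 1#) * binom (α + nat k) k
  absorption-shifted α k =
    trans (*-cong refl (binom-cong (suc k) (trans (+-cong refl (nat-suc k)) (sym (+-assoc _ _ _)))))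
          (absorption (α + nat k) k)

  coeff-telescoping : ∀ α k j →
    (nat k + nat (suc j)) * coeff (α + 1#) α (suc j) k ≈ nat k * coeff α α (suc j) k - nat (suc k) * coeff α α j (suc k)
  coeff-telescoping α k j = begin
    (nat k + nat (suc j)) * (binom (α + 1#) (suc j) * B * - s)
      ≈⟨ solve 4 (λ N C B s → N :* (C :* B :* (:- s)) := N :* C :* B :* (:- s)) refl
           (nat k + nat (suc j)) (binom (α + 1#) (suc j)) B s ⟩
    (nat k + nat (suc j)) * binom (α + 1#) (suc j) * B * - s
      ≈⟨ *-cong (*-cong (pascal-weighted α (nat k) j) refl) refl ⟩
    (nat k * C₁ + (α + nat k + 1#) * C₀) * B * - s
      ≈⟨ solve 6 (λ K A C₁ C₀ B s → (K :* C₁ :+ A :* C₀) :* B :* (:- s) := K :* (C₁ :* B :* (:- s)) :- A :* B :* C₀ :* s) refl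
           (nat k) (α + nat k + 1#) C₁ C₀ B s ⟩
    nat k * (C₁ * B * - s) - (α + nat k + 1#) * B * C₀ * s
      ≈⟨ +-cong refl (-‿cong (*-cong (*-cong (sym (absorption-shifted α k)) refl) refl)) ⟩
    nat k * (C₁ * B * - s) - nat (suc k) * B′ * C₀ * s
      ≈⟨ +-cong refl (-‿cong (solve 4 (λ N B′ C₀ s → N :* B′ :* C₀ :* s := N :* (C₀ :* B′ :* s)) refl (nat (suc k)) B′ C₀ s)) ⟩
    nat k * (C₁ * B * - s) - nat (suc k) * (C₀ * B′ * s) ∎
    where
    B  = binom (α + nat k) k
    B′ = binom (α + nat (suc k)) (suc k)
    C₁ = binom α (suc j)
    C₀ = binom α j
    s  = sign j

  weight-telescoping : ∀ α m k → k ≤ m →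
    nat (suc m) * coeff (α + 1#) α (suc m ∸ k) k ≈ weight α (suc m) k - weight α (suc m) (suc k)
  weight-telescoping α m k k≤m = begin
    nat n * coeff (α + 1#) α (n ∸ k) k
      ≡⟨ cong₂ (λ N j → nat N * coeff (α + 1#) α j k) (≡.sym k+[n∸k]≡) n∸k≡ ⟩
    nat (k ℕ.+ suc j) * coeff (α + 1#) α (suc j) k           ≈⟨ *-cong (nat-+ k (suc j)) refl ⟩
    (nat k + nat (suc j)) * coeff (α + 1#) α (suc j) k       ≈⟨ coeff-telescoping α k j ⟩
    nat k * coeff α α (suc j) k - weight α n (suc k)
      ≡⟨ cong (λ i → nat k * coeff α α i k - weight α n (suc k)) (≡.sym n∸k≡) ⟩
    weight α n k - weight α n (suc k) ∎
    where
    n = suc m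
    j = m ∸ k
    n∸k≡ : n ∸ k ≡ suc j
    n∸k≡ = proj₁ (index-split k≤m)
    k+[n∸k]≡ : k ℕ.+ suc j ≡ n
    k+[n∸k]≡ = proj₂ (index-split k≤m)

  S-by-parts : ∀ α h m →
    nat (suc m) * S (α + 1#) α h (suc m) ≈ sum1 (suc m) (λ k → weight α (suc m) k * (h k - h (k ∸ 1)))
  S-by-parts α h m = begin
    nat n * (sum0 m T + T n)                              ≈⟨ distribˡ (nat n) _ _ ⟩
    nat n * sum0 m T + nat n * T n                        ≈⟨ +-cong (trans (sum0-scale m (nat n) T) (sum0-cong m inner)) last ⟩
    sum0 m (λ k → (w k - w (suc k)) * h k) + w n * h n    ≈⟨ summation-by-parts m w h ⟩
    w 0 * h 0 + sum1 n D                                  ≈⟨ trans (+-cong w₀h₀≈0 refl) (+-identityˡ _) ⟩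
    sum1 n D                                              ∎
    where
    n = suc m
    w T D : ℕ → Carrier
    w = weight α n
    T k = coeff (α + 1#) α (n ∸ k) k * h k
    D k = w k * (h k - h (k ∸ 1))
    inner : ∀ k → k ≤ m → nat n * T k ≈ (w k - w (suc k)) * h k
    inner k k≤m = trans (sym (*-assoc _ _ _)) (*-cong (weight-telescoping α m k k≤m) refl)
    last : nat n * T n ≈ w n * h n
    last = trans (*-cong refl (*-cong (reflexive (coeff-last (α + 1#) α α n)) refl)) (sym (*-assoc _ _ _))
    w₀h₀≈0 : w 0 * h 0 ≈ 0#
    w₀h₀≈0 = trans (*-cong (trans (*-cong nat-zero refl) (zeroˡ _)) refl) (zeroˡ _)

  H-zero : H 0 ≈ 0#
  H-zero = ι.0#-homo

  H-suc : ∀ k → H (suc k) ≈ H k + invSuc k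
  H-suc k = ι.+-homo (harmonic k) (recipSuc k)

  H-difference : ∀ j → H (suc j) - H j ≈ invSuc j
  H-difference j = trans (+-cong (H-suc j) refl)
    (solve 2 (λ h i → h :+ i :- h := i) refl (H j) (invSuc j))

  -- For h ≡ 1 the right-hand side of (2) vanishes: S(α+1, α, 1, n) = 0 for n ≥ 1.
  S-by-parts-one : ∀ α m → S (α + 1#) α (λ _ → 1#) (suc m) ≈ 0#
  S-by-parts-one α m = trans (nat-divide m (trans (S-by-parts α (λ _ → 1#) m) (sum1-zero (suc m) _ zero-term))) (zeroʳ _)
    where
    zero-term : ∀ j → weight α (suc m) (suc j) * (1# - 1#) ≈ 0#
    zero-term j = trans (*-cong refl (-‿inverseʳ 1#)) (zeroʳ _)

  vandermonde : ∀ α n → S α α (λ _ → 1#) n ≈ 1#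
  vandermonde α zero = trans (*-identityʳ _) (trans (*-identityʳ _)
    (trans (*-cong (binom-zero α) (binom-zero (α + nat 0))) (*-identityˡ 1#)))
  vandermonde α (suc m) = begin
    S α α (λ _ → 1#) (suc m)                                   ≈⟨ S-recurrence α (λ _ → 1#) m ⟩
    S (α + 1#) α (λ _ → 1#) (suc m) + S α α (λ _ → 1#) m       ≈⟨ +-cong (S-by-parts-one α m) (vandermonde α m) ⟩
    0# + 1#                                                    ≈⟨ +-identityˡ 1# ⟩
    1#                                                         ∎

  weight-harmonic : ∀ α n j → weight α n (suc j) * (H (suc j) - H j) ≈ coeff α α (n ∸ suc j) (suc j) * 1#
  weight-harmonic α n j = begin
    nat (suc j) * c * (H (suc j) - H j)   ≈⟨ *-cong refl (H-difference j) ⟩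
    nat (suc j) * c * invSuc j            ≈⟨ solve 3 (λ N c I → N :* c :* I := c :* (N :* I)) refl (nat (suc j)) c (invSuc j) ⟩
    c * (nat (suc j) * invSuc j)          ≈⟨ *-cong refl (nat-*-invSuc j) ⟩
    c * 1#                                ∎
    where c = coeff α α (n ∸ suc j) (suc j)

  first-identity : ∀ α m → S (α + 1#) α H (suc m) ≈ invSuc m + binom α (suc m) * sign m * invSuc m
  first-identity α m = trans (nat-divide m by-parts)
    (solve 3 (λ I C s → I :* (con 1ℚ :+ C :* s) := I :+ C :* s :* I) refl (invSuc m) (binom α n) (sign m))
    where
    n = suc m
    c : ℕ → Carrier
    c k = coeff α α (n ∸ k) k * 1#
    by-parts : nat n * S (α + 1#) α H n ≈ ι 1ℚ + binom α n * sign m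
    by-parts = begin
      nat n * S (α + 1#) α H n        ≈⟨ trans (S-by-parts α H m) (sum1-cong n (weight-harmonic α n)) ⟩
      sum1 n c                        ≈⟨ solve 2 (λ S c₀ → S := c₀ :+ S :- c₀) refl (sum1 n c) (c 0) ⟩
      c 0 + sum1 n c - c 0            ≈⟨ +-cong (trans (sym (sum0-split n c)) (vandermonde α n)) refl ⟩
      1# - binom α n * binom (α + nat 0) 0 * - sign m * 1#
        ≈⟨ +-cong (sym ι.1#-homo) (-‿cong (*-cong (*-cong (*-cong refl (binom-zero (α + nat 0))) refl) refl)) ⟩
      ι 1ℚ - binom α n * 1# * - sign m * 1#
        ≈⟨ solve 3 (λ C u s → con 1ℚ :- C :* u :* (:- s) :* u := con 1ℚ :+ C :* s :* (u :* u)) refl (binom α n) 1# (sign m) ⟩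
      ι 1ℚ + binom α n * sign m * (1# * 1#)   ≈⟨ +-cong refl (trans (*-cong refl (*-identityˡ 1#)) (*-identityʳ _)) ⟩
      ι 1ℚ + binom α n * sign m       ∎

  G : Carrier → ℕ → Carrier
  G a N = sum1 N (λ k → binom a k * sign (k ∸ 1) * invSuc (k ∸ 1))

  -- Second identity: Σ_k C(α, n-k) C(α+k, k) (-1)^{n-k} H_k = H_n + G(α, n), by telescoping (1).
  second-identity : ∀ α n → S α α H n ≈ H n + G α n
  second-identity α zero = trans (trans (*-cong refl H-zero) (zeroʳ _)) (sym (trans (+-identityʳ _) H-zero))
  second-identity α (suc m) = begin
    S α α H (suc m)                                               ≈⟨ S-recurrence α H m ⟩
    S (α + 1#) α H (suc m) + S α α H m                            ≈⟨ +-cong (first-identity α m) (second-identity α m) ⟩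
    invSuc m + binom α (suc m) * sign m * invSuc m + (H m + G α m)
      ≈⟨ solve 4 (λ I t h g → I :+ t :+ (h :+ g) := h :+ I :+ (g :+ t)) refl (invSuc m) (binom α (suc m) * sign m * invSuc m) (H m) (G α m) ⟩
    H m + invSuc m + G α (suc m)                                  ≈⟨ +-cong (sym (H-suc m)) refl ⟩
    H (suc m) + G α (suc m)                                       ∎

  G-cong : ∀ {a b} N → a ≈ b → G a N ≈ G b N
  G-cong N a≈b = sum1-cong N (λ j → *-cong (*-cong (binom-cong (suc j) a≈b) refl) refl)

  G-upper-difference : ∀ a N → (a + 1#) * (G (a + 1#) N - G a N) ≈ sum1 N (λ k → binom (a + 1#) k * sign (k ∸ 1))
  G-upper-difference a N = trans (sum1-scale-sub N (a + 1#) _ _) (sum1-cong N term)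
    where
    term : ∀ j → (a + 1#) * (binom (a + 1#) (suc j) * sign j * invSuc j - binom a (suc j) * sign j * invSuc j)
                   ≈ binom (a + 1#) (suc j) * sign j
    term j = begin
      (a + 1#) * (C′ * s * I - binom a (suc j) * s * I)
        ≈⟨ *-cong refl ([y-z]x≈yx-zx I (C′ * s) (binom a (suc j) * s)) ⟨
      (a + 1#) * ((C′ * s - binom a (suc j) * s) * I)
        ≈⟨ *-cong refl (*-cong ([y-z]x≈yx-zx s C′ (binom a (suc j))) refl) ⟨
      (a + 1#) * ((C′ - binom a (suc j)) * s * I)
        ≈⟨ *-cong refl (*-cong (*-cong C′-C≈ refl) refl) ⟩
      (a + 1#) * (binom a j * s * I)
        ≈⟨ solve 4 (λ A C s I → A :* (C :* s :* I) := A :* C :* s :* I) refl (a + 1#) (binom a j) s I ⟩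
      (a + 1#) * binom a j * s * I          ≈⟨ *-cong (*-cong (absorption a j) refl) refl ⟨
      nat (suc j) * C′ * s * I              ≈⟨ solve 4 (λ N C s I → N :* C :* s :* I := C :* s :* (N :* I)) refl (nat (suc j)) C′ s I ⟩
      C′ * s * (nat (suc j) * I)            ≈⟨ trans (*-cong refl (nat-*-invSuc j)) (*-identityʳ _) ⟩
      C′ * s                                ∎
      where
      C′ = binom (a + 1#) (suc j)
      s  = sign j
      I  = invSuc j
      C′-C≈ : C′ - binom a (suc j) ≈ binom a j
      C′-C≈ = trans (+-cong (pascal a j) refl)
        (solve 2 (λ C₁ C₀ → C₁ :+ C₀ :- C₁ := C₀) refl (binom a (suc j)) (binom a j))

  alternating-binom : ∀ a N → sum1 N (λ k → binom (a + 1#) k * sign (k ∸ 1)) ≈ 1# - sign N * binom a N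
  alternating-binom a zero =
    sym (trans (+-cong refl (-‿cong (trans (*-identityˡ _) (binom-zero a)))) (-‿inverseʳ 1#))
  alternating-binom a (suc N) = begin
    sum1 N (λ k → binom (a + 1#) k * sign (k ∸ 1)) + binom (a + 1#) (suc N) * sign N
      ≈⟨ +-cong (alternating-binom a N) (*-cong (pascal a N) refl) ⟩
    1# - sign N * binom a N + (binom a (suc N) + binom a N) * sign N
      ≈⟨ solve 4 (λ u s C₀ C₁ → u :- s :* C₀ :+ (C₁ :+ C₀) :* s := u :- (:- s) :* C₁) refl 1# (sign N) (binom a N) (binom a (suc N)) ⟩
    1# - - sign N * binom a (suc N) ∎

  -- C(N, N+1) = 0, so G(N, N+1) = G(N, N).
  G-past-diagonal : ∀ N → G (nat N) (suc N) ≈ G (nat N) N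
  G-past-diagonal N = trans (+-cong refl vanishing) (+-identityʳ _)
    where
    vanishing : binom (nat N) (suc N) * sign N * invSuc N ≈ 0#
    vanishing = trans (*-cong (trans (*-cong (binom-above-diagonal N) refl) (zeroˡ _)) refl) (zeroˡ _)

  -- G(N, N) = H_N: the increment G(N+1, N+1) - G(N, N+1) equals 1/(N+1).
  G-diagonal : ∀ N → G (nat N) N ≈ H N
  G-diagonal zero    = sym H-zero
  G-diagonal (suc N) = begin
    G (nat (suc N)) (suc N)             ≈⟨ solve 2 (λ A B → A := B :+ (A :- B)) refl (G (nat (suc N)) (suc N)) (G (nat N) (suc N)) ⟩
    G (nat N) (suc N) + Δ               ≈⟨ +-cong (trans (G-past-diagonal N) (G-diagonal N)) (trans (nat-divide N increment) (*-identityʳ _)) ⟩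
    H N + invSuc N                      ≈⟨ sym (H-suc N) ⟩
    H (suc N)                           ∎
    where
    Δ = G (nat (suc N)) (suc N) - G (nat N) (suc N)
    increment : nat (suc N) * Δ ≈ 1#
    increment = begin
      nat (suc N) * Δ                   ≈⟨ *-cong (nat-suc N) (+-cong (G-cong (suc N) (nat-suc N)) refl) ⟩
      (nat N + 1#) * (G (nat N + 1#) (suc N) - G (nat N) (suc N))
                                        ≈⟨ trans (G-upper-difference (nat N) (suc N)) (alternating-binom (nat N) (suc N)) ⟩
      1# - sign (suc N) * binom (nat N) (suc N)
                                        ≈⟨ +-cong refl (-‿cong (trans (*-cong refl (binom-above-diagonal N)) (zeroʳ _))) ⟩
      1# - 0#                           ≈⟨ trans (+-cong refl -0#≈0#) (+-identityʳ 1#) ⟩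
      1#                                ∎

corollary6 : ∀ {c ℓ : Level} (R : CommutativeRing c ℓ)
    (ι : ℚ → CommutativeRing.Carrier R) → IsℚAlgebraMap R ι →
    let open CommutativeRing R
        open QAlg R ι
    in (α : Carrier) (m : ℕ) →
       let n = suc m in
       (sum0 n (λ k → binom (α + 1#) (n ∸ k) * binom (α + nat k) k * sign (n ∸ k) * H k)
          ≈ invSuc m + binom α n * sign m * invSuc m)
       × (sum0 n (λ k → binom α (n ∸ k) * binom (α + nat k) k * sign (n ∸ k) * H k)
          ≈ H n + sum1 n (λ k → binom α k * sign (k ∸ 1) * invSuc (k ∸ 1)))
       × (sum0 n (λ k → binom (nat n + 1#) (n ∸ k) * binom (nat n + nat k) k * sign (n ∸ k) * H k)
          ≈ (1# + sign m) * invSuc m)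
       × (sum0 n (λ k → binom (nat n) (n ∸ k) * binom (nat n + nat k) k * sign (n ∸ k) * H k)
          ≈ (1# + 1#) * H n)
corollary6 R ι ι-hom α m =
  first-identity α m , second-identity α (suc m) , third , fourth
  where
  open CommutativeRing R
  open QAlg R ι
  open InℚAlgebra R ι ι-hom
  open import Relation.Binary.Reasoning.Setoid setoid
  n = suc m
  third : S (nat n + 1#) (nat n) H n ≈ (1# + sign m) * invSuc m
  third = begin
    S (nat n + 1#) (nat n) H n                          ≈⟨ first-identity (nat n) m ⟩
    invSuc m + binom (nat n) n * sign m * invSuc m      ≈⟨ +-cong refl (*-cong (trans (*-cong (binom-diagonal n) refl) (*-identityˡ _)) refl) ⟩
    invSuc m + sign m * invSuc m                        ≈⟨ trans (distribʳ _ _ _) (+-cong (*-identityˡ _) refl) ⟨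
    (1# + sign m) * invSuc m                            ∎
  fourth : S (nat n) (nat n) H n ≈ (1# + 1#) * H n
  fourth = begin
    S (nat n) (nat n) H n                               ≈⟨ second-identity (nat n) n ⟩
    H n + G (nat n) n                                   ≈⟨ +-cong refl (G-diagonal n) ⟩
    H n + H n                                           ≈⟨ trans (distribʳ _ _ _) (+-cong (*-identityˡ _) (*-identityˡ _)) ⟨
    (1# + 1#) * H n                                     ∎
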